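{- Let $a,b$ be relatively prime positive integers, $n\ge1$, and let $\pi$ be an $(a,b)$-Dyck path of size $n$ with step sequence $\mathbf{u}=(u_1,\dots,u_{an})$. Define vectors $\mathbf{v}_1,\dots,\mathbf{v}_b\in\mathbb{Z}_{\ge0}^{an}$ by $$\mathbf{v}_1=\left\lceil \mathbf{u}/b\right\rceil,\qquad \mathbf{v}_k=\left\lceil \frac{\mathbf{u}-\mathbf{v}_1-\cdots-\mathbf{v}_{k-1}}{b-k+1}\right\rceil\quad (2\le k\le b),$$ where division and ceiling are taken componentwise. Let $\theta_h(\pi)=(p_1,\dots,p_b)$ be the horizontal strip decomposition of $\pi$. Then for each $i\in[1,b]$, $\mathbf{v}_i$ is the step sequence of the lattice path $p_i$.
   Context: An $(a,b)$-Dyck path of size $n$ is a lattice path from $(0,0)$ to $(bn,an)$ with unit steps $N=(0,1)$, $E=(1,0)$ that never goes below the line $y=ax/b$. For a lattice path with $A$ north steps, its step sequence is $(u_1,\dots,u_A)$ where $u_k$ is the $x$-coordinate of the $k$-th north step (the path uses the edge from $(u_k,k-1)$ to $(u_k,k)$). For a lattice path with $B$ east steps, its height sequence is $(h_1,\dots,h_B)$ where $h_k$ is the $y$-coordinate of the $k$-th east step (the edge from $(k-1,h_k)$ to $(k,h_k)$). A lattice path is determined by its endpoints and either sequence. Horizontal strip decomposition: if $\pi$ has height sequence $(h_1,\dots,h_{bn})$, then for $i\in[1,b]$, $p_i$ is the lattice path from $(0,0)$ to $(n,an)$ whose height sequence is $(h_i,h_{b+i},h_{2b+i},\dots,h_{(n-1)b+i})$;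 $\theta_h(\pi)=(p_1,\dots,p_b)$. -}

module Defs where

open import Data.Nat using (ℕ; zero; suc; _+_; _*_; _∸_; _≤_; _/_)
open import Relation.Binary.PropositionalEquality using (_≡_)
open import Data.Product using (_×_)
open import Data.List using (List; []; _∷_; map; zipWith; upTo; take; length)

-- Unit steps of a lattice path: N = (0,1), E = (1,0).
data Step : Set where
  N E : Step

countN : List Step → ℕ
countN []      = 0
countN (N ∷ s) = suc (countN s)
countN (E ∷ s) = countN s

countE : List Step → ℕ
countE []      = 0
countE (N ∷ s) = countE s
countE (E ∷ s) = suc (countE s)

IsLatticePath : ℕ → ℕ → List Step → Set
IsLatticePath B A p = (countE p ≡ B) × (countN p ≡ A)

IsDyck : ℕ → ℕ → ℕ → List Step → Set
IsDyck a b n p =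
  IsLatticePath (b * n) (a * n) p ×
  ((k : ℕ) → a * countE (take k p) ≤ b * countN (take k p))

stepSeqFrom : ℕ → List Step → List ℕ
stepSeqFrom x []      = []
stepSeqFrom x (N ∷ s) = x ∷ stepSeqFrom x s
stepSeqFrom x (E ∷ s) = stepSeqFrom (suc x) s

stepSeq : List Step → List ℕ
stepSeq = stepSeqFrom 0

heightSeqFrom : ℕ → List Step → List ℕ
heightSeqFrom y []      = []
heightSeqFrom y (N ∷ s) = heightSeqFrom (suc y) s
heightSeqFrom y (E ∷ s) = y ∷ heightSeqFrom y s

heightSeq : List Step → List ℕ
heightSeq = heightSeqFrom 0

-- j-th entry (0-indexed) of a list, with default 0 out of range
-- (only used at in-range indices).
nth : List ℕ → ℕ → ℕ
nth []       _       = 0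
nth (x ∷ xs) zero    = x
nth (x ∷ xs) (suc j) = nth xs j

-- For 0-indexed i (paper's index i+1), the subsequence
-- (h_{i+1}, h_{b+i+1}, ..., h_{(n-1)b+i+1}) of h (1-indexed in the paper).
strip : ℕ → ℕ → ℕ → List ℕ → List ℕ
strip b n i h = map (λ m → nth h (m * b + i)) (upTo n)

-- Ceiling of x / (suc m).
ceilDivSuc : ℕ → ℕ → ℕ
ceilDivSuc x m = (x + m) / suc m

-- Residuals: res b u 0 = u ; res b u (j+1) = res b u j - v_{j+1} (componentwise).
-- vvec b u j = v_{j+1} = ⌈ res b u j / (b - j) ⌉ componentwise, for 0 ≤ j < b;
-- here b - j is written suc (b ∸ suc j), which equals b - j when j < b.
mutual
  res : ℕ → List ℕ → ℕ → List ℕ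
  res b u zero    = u
  res b u (suc j) = zipWith _∸_ (res b u j) (vvec b u j)

  vvec : ℕ → List ℕ → ℕ → List ℕ
  vvec b u j = map (λ x → ceilDivSuc x (b ∸ suc j)) (res b u j)

-- The k-th north step of a lattice path lies at x = number of its east steps below
-- height k. Heights of east steps weakly increase, so the east steps of π below height k
-- are exactly its first c = u_k ones, and the strip path p_{i+1} (east steps of π with
-- 0-based index ≡ i mod b) has #{m < n : m b + i < c} of them. Writing c = q b + s with
-- s < b, this count is q + [i < s]. On the other side, the recursion turns an entry c of
-- u into the residual q (b − j) + (s − j)⁺ after j steps, so the entry of v_{i+1} is
-- ⌈(q (b − i) + (s − i)⁺) / (b − i)⌉ = q + [i < s] as well.
module Submission where

open import Defs
open import Data.Nat using (ℕ; zero; suc; pred; _+_; _*_; _∸_; _≤_; _<_; z≤n; s≤s; _/_; _%_)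
open import Data.Nat.Properties
open import Data.Nat.DivMod using (m≡m%n+[m/n]*n; m%n<n; m*n/n≡m; m<n⇒m/n≡0; +-distrib-/-∣ˡ)
open import Data.Nat.Divisibility using (n∣m*n)
open import Data.Nat.Coprimality using (Coprime)
open import Data.Fin using (Fin; toℕ)
open import Data.Fin.Properties using (toℕ<n)
open import Data.List using (List; []; _∷_; map; zipWith; upTo; applyUpTo; length; replicate; _++_)
open import Data.List.Properties using (map-upTo; map-applyUpTo; length-applyUpTo; map-cong; map-∘; map-id; ++-identityʳ)
open import Data.List.Relation.Unary.All as All using (All; []; _∷_)
open import Data.List.Relation.Unary.All.Properties using (applyUpTo⁺₁; applyUpTo⁺₂)
open import Data.List.Relation.Unary.AllPairs using (AllPairs; []; _∷_)
open import Data.List.Relation.Unary.AllPairs.Properties as AllPairs using ()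
open import Function using (_∘_)
open import Data.Product using (_×_; ∃-syntax; _,_)
open import Relation.Binary.PropositionalEquality
open import Relation.Nullary using (yes; no)

𝟙[_<_] : ℕ → ℕ → ℕ
𝟙[ _     < zero  ] = 0
𝟙[ zero  < suc n ] = 1
𝟙[ suc m < suc n ] = 𝟙[ m < n ]

<⇒𝟙≡1 : ∀ {m n} → m < n → 𝟙[ m < n ] ≡ 1
<⇒𝟙≡1 {zero}  {suc n} _          = refl
<⇒𝟙≡1 {suc m} {suc n} (s≤s m<n) = <⇒𝟙≡1 m<n

≥⇒𝟙≡0 : ∀ {m n} → n ≤ m → 𝟙[ m < n ] ≡ 0
≥⇒𝟙≡0 {m}     {zero}  _          = refl
≥⇒𝟙≡0 {suc m} {suc n} (s≤s n≤m) = ≥⇒𝟙≡0 n≤m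

𝟙≤1 : ∀ m n → 𝟙[ m < n ] ≤ 1
𝟙≤1 _       zero    = z≤n
𝟙≤1 zero    (suc n) = s≤s z≤n
𝟙≤1 (suc m) (suc n) = 𝟙≤1 m n

𝟙-+-cancelˡ : ∀ k m n → 𝟙[ k + m < k + n ] ≡ 𝟙[ m < n ]
𝟙-+-cancelˡ zero    m n = refl
𝟙-+-cancelˡ (suc k) m n = 𝟙-+-cancelˡ k m n

𝟙[0<n∸m]≡𝟙[m<n] : ∀ m n → 𝟙[ 0 < n ∸ m ] ≡ 𝟙[ m < n ]
𝟙[0<n∸m]≡𝟙[m<n] zero    n       = refl
𝟙[0<n∸m]≡𝟙[m<n] (suc m) zero    = refl
𝟙[0<n∸m]≡𝟙[m<n] (suc m) (suc n) = 𝟙[0<n∸m]≡𝟙[m<n] m n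

count< : ℕ → List ℕ → ℕ
count< c []       = 0
count< c (x ∷ xs) = 𝟙[ x < c ] + count< c xs

count<≤length : ∀ c xs → count< c xs ≤ length xs
count<≤length c []       = z≤n
count<≤length c (x ∷ xs) = +-mono-≤ (𝟙≤1 x c) (count<≤length c xs)

count<-all≥ : ∀ {c xs} → All (c ≤_) xs → count< c xs ≡ 0
count<-all≥ []             = refl
count<-all≥ (c≤x ∷ c≤xs) = cong₂ _+_ (≥⇒𝟙≡0 c≤x) (count<-all≥ c≤xs)

count<-applyUpTo-cong : ∀ {c d} (f g : ℕ → ℕ) n → (∀ {m} → m < n → 𝟙[ f m < c ] ≡ 𝟙[ g m < d ]) →
                        count< c (applyUpTo f n) ≡ count< d (applyUpTo g n)
count<-applyUpTo-cong f g zero    f≈g = refl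
count<-applyUpTo-cong f g (suc n) f≈g =
  cong₂ _+_ (f≈g (s≤s z≤n)) (count<-applyUpTo-cong (f ∘ suc) (g ∘ suc) n (f≈g ∘ s≤s))

applyUpTo-cong : ∀ {f g : ℕ → ℕ} n → (∀ k → f k ≡ g k) → applyUpTo f n ≡ applyUpTo g n
applyUpTo-cong {f} {g} n f≗g = begin
  applyUpTo f n    ≡⟨ map-upTo f n ⟨
  map f (upTo n)   ≡⟨ map-cong f≗g (upTo n) ⟩
  map g (upTo n)   ≡⟨ map-upTo g n ⟩
  applyUpTo g n    ∎
  where open ≡-Reasoning

heightSeqFrom-≥ : ∀ y s → All (y ≤_) (heightSeqFrom y s)
heightSeqFrom-≥ y []      = []
heightSeqFrom-≥ y (N ∷ s) = All.map <⇒≤ (heightSeqFrom-≥ (suc y) s)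
heightSeqFrom-≥ y (E ∷ s) = ≤-refl ∷ heightSeqFrom-≥ y s

heightSeqFrom-≤ : ∀ y s → All (_≤ y + countN s) (heightSeqFrom y s)
heightSeqFrom-≤ y []      = []
heightSeqFrom-≤ y (N ∷ s) =
  subst (λ top → All (_≤ top) (heightSeqFrom (suc y) s)) (sym (+-suc y (countN s))) (heightSeqFrom-≤ (suc y) s)
heightSeqFrom-≤ y (E ∷ s) = m≤m+n y (countN s) ∷ heightSeqFrom-≤ y s

heightSeqFrom-sorted : ∀ y s → AllPairs _≤_ (heightSeqFrom y s)
heightSeqFrom-sorted y []      = []
heightSeqFrom-sorted y (N ∷ s) = heightSeqFrom-sorted (suc y) s
heightSeqFrom-sorted y (E ∷ s) = heightSeqFrom-≥ y s ∷ heightSeqFrom-sorted y s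

length-heightSeqFrom : ∀ y s → length (heightSeqFrom y s) ≡ countE s
length-heightSeqFrom y []      = refl
length-heightSeqFrom y (N ∷ s) = length-heightSeqFrom (suc y) s
length-heightSeqFrom y (E ∷ s) = cong suc (length-heightSeqFrom y s)

stepSeqFrom-counts : ∀ x y s →
  stepSeqFrom x s ≡ applyUpTo (λ k → x + count< (suc (y + k)) (heightSeqFrom y s)) (countN s)
stepSeqFrom-counts x y []      = refl
stepSeqFrom-counts x y (N ∷ s) = cong₂ _∷_ startsAtx rest
  where
  startsAtx : x ≡ x + count< (suc (y + 0)) (heightSeqFrom (suc y) s)
  startsAtx = sym (trans (cong (x +_) (count<-all≥ (All.map (≤-trans (s≤s (≤-reflexive (+-identityʳ y))))
                                                             (heightSeqFrom-≥ (suc y) s))))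
                         (+-identityʳ x))
  rest : stepSeqFrom x s ≡ applyUpTo (λ k → x + count< (suc (y + suc k)) (heightSeqFrom (suc y) s)) (countN s)
  rest = trans (stepSeqFrom-counts x (suc y) s)
               (applyUpTo-cong (countN s)
                  (λ k → cong (λ z → x + count< (suc z) (heightSeqFrom (suc y) s)) (sym (+-suc y k))))
stepSeqFrom-counts x y (E ∷ s) = trans (stepSeqFrom-counts (suc x) y s) (applyUpTo-cong (countN s) eastBelow)
  where
  eastBelow : ∀ k → suc x + count< (suc (y + k)) (heightSeqFrom y s)
                  ≡ x + (𝟙[ y < suc (y + k) ] + count< (suc (y + k)) (heightSeqFrom y s))
  eastBelow k = sym (trans (cong (λ one → x + (one + count< (suc (y + k)) (heightSeqFrom y s)))
                                (<⇒𝟙≡1 (s≤s (m≤m+n y k))))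
                          (+-suc x _))

stepSeq-counts : ∀ p → stepSeq p ≡ applyUpTo (λ k → count< (suc k) (heightSeq p)) (countN p)
stepSeq-counts = stepSeqFrom-counts 0 0

nth∈All : ∀ {P : ℕ → Set} {xs} j → All P xs → j < length xs → P (nth xs j)
nth∈All zero    (px ∷ _)   _          = px
nth∈All (suc j) (_  ∷ pxs) (s≤s j<n) = nth∈All j pxs j<n

sorted-nth-mono : ∀ {H j j′} → AllPairs _≤_ H → j ≤ j′ → j′ < length H → nth H j ≤ nth H j′
sorted-nth-mono {_ ∷ _} {zero}  {zero}    _               _          _           = ≤-refl
sorted-nth-mono {_ ∷ _} {zero}  {suc j′}  (x≤H ∷ _)      _          (s≤s j′<n) = nth∈All j′ x≤H j′<n
sorted-nth-mono {_ ∷ _} {suc j} {suc j′}  (_ ∷ sorted)   (s≤s j≤j′) (s≤s j′<n) = sorted-nth-mono sorted j≤j′ j′<n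

-- In a sorted list the entries below c form an initial segment, of length count< c H.
sorted-nth<⇔<count< : ∀ c {H} j → AllPairs _≤_ H → j < length H → 𝟙[ nth H j < c ] ≡ 𝟙[ j < count< c H ]
sorted-nth<⇔<count< c {x ∷ H} j (x≤H ∷ sorted) j<n with x <? c
... | yes x<c rewrite <⇒𝟙≡1 x<c = below j j<n
  where
  below : ∀ j → j < suc (length H) → 𝟙[ nth (x ∷ H) j < c ] ≡ 𝟙[ j < suc (count< c H) ]
  below zero    _          = <⇒𝟙≡1 x<c
  below (suc j) (s≤s j<n) = sorted-nth<⇔<count< c j sorted j<n
... | no x≮c rewrite ≥⇒𝟙≡0 (≮⇒≥ x≮c) | count<-all≥ (All.map (≤-trans (≮⇒≥ x≮c)) x≤H) =
  ≥⇒𝟙≡0 (≤-trans (≮⇒≥ x≮c) (sorted-nth-mono (x≤H ∷ sorted) z≤n j<n))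

/-+-multiple : ∀ d k m → (k * suc d + m) / suc d ≡ k + m / suc d
/-+-multiple d k m = trans (+-distrib-/-∣ˡ m (n∣m*n k)) (cong (_+ m / suc d) (m*n/n≡m k (suc d)))

ceilDivSuc-≤ : ∀ d r → r ≤ d → ceilDivSuc r d ≡ 𝟙[ 0 < r ]
ceilDivSuc-≤ d zero    _   = m<n⇒m/n≡0 (n<1+n d)
ceilDivSuc-≤ d (suc r) r<d = begin
  (suc r + d) / suc d        ≡⟨ cong (λ z → suc z / suc d) (trans (+-comm r d) (cong (_+ r) (sym (+-identityʳ d)))) ⟩
  (1 * suc d + r) / suc d    ≡⟨ /-+-multiple d 1 r ⟩
  suc (r / suc d)            ≡⟨ cong suc (m<n⇒m/n≡0 (m<n⇒m<1+n r<d)) ⟩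
  1                          ∎
  where open ≡-Reasoning

ceilDivSuc-multiple : ∀ d q r → r ≤ d → ceilDivSuc (q * suc d + r) d ≡ q + 𝟙[ 0 < r ]
ceilDivSuc-multiple d q r r≤d = begin
  (q * suc d + r + d) / suc d    ≡⟨ cong (_/ suc d) (+-assoc (q * suc d) r d) ⟩
  (q * suc d + (r + d)) / suc d  ≡⟨ /-+-multiple d q (r + d) ⟩
  q + ceilDivSuc r d             ≡⟨ cong (q +_) (ceilDivSuc-≤ d r r≤d) ⟩
  q + 𝟙[ 0 < r ]                 ∎
  where open ≡-Reasoning

∸-ceilDivSuc : ∀ d q r → r ≤ d → q * suc d + r ∸ ceilDivSuc (q * suc d + r) d ≡ q * d + pred r
∸-ceilDivSuc d q r r≤d = begin
  q * suc d + r ∸ ceilDivSuc (q * suc d + r) d  ≡⟨ cong (q * suc d + r ∸_) (ceilDivSuc-multiple d q r r≤d) ⟩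
  q * suc d + r ∸ (q + 𝟙[ 0 < r ])              ≡⟨ cong (λ z → z + r ∸ (q + 𝟙[ 0 < r ])) (*-suc q d) ⟩
  q + q * d + r ∸ (q + 𝟙[ 0 < r ])              ≡⟨ cong (_∸ (q + 𝟙[ 0 < r ])) (+-assoc q (q * d) r) ⟩
  q + (q * d + r) ∸ (q + 𝟙[ 0 < r ])            ≡⟨ [m+n]∸[m+o]≡n∸o q (q * d + r) 𝟙[ 0 < r ] ⟩
  q * d + r ∸ 𝟙[ 0 < r ]                        ≡⟨ dropOne r ⟩
  q * d + pred r                                ∎
  where
  open ≡-Reasoning
  dropOne : ∀ r → q * d + r ∸ 𝟙[ 0 < r ] ≡ q * d + pred r
  dropOne zero    = refl
  dropOne (suc r) = cong (_∸ 1) (+-suc (q * d) r)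

residual : ℕ → ℕ → ℕ → ℕ
residual b zero    x = x
residual b (suc j) x = residual b j x ∸ ceilDivSuc (residual b j x) (b ∸ suc j)

res-map : ∀ b u j → res b u j ≡ map (residual b j) u
res-map b u zero    = sym (map-id u)
res-map b u (suc j) rewrite res-map b u j = zipWith-∸-map u
  where
  zipWith-∸-map : ∀ u → zipWith _∸_ (map (residual b j) u) (map (λ x → ceilDivSuc x (b ∸ suc j)) (map (residual b j) u))
                        ≡ map (residual b (suc j)) u
  zipWith-∸-map []      = refl
  zipWith-∸-map (x ∷ u) = cong (residual b (suc j) x ∷_) (zipWith-∸-map u)

vvec-map : ∀ b u j → vvec b u j ≡ map (λ x → ceilDivSuc (residual b j x) (b ∸ suc j)) u
vvec-map b u j rewrite res-map b u j = sym (map-∘ u)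

m∸n≡1+[m∸1+n] : ∀ m n → n < m → m ∸ n ≡ suc (m ∸ suc n)
m∸n≡1+[m∸1+n] (suc m) zero    _          = refl
m∸n≡1+[m∸1+n] (suc m) (suc n) (s≤s n<m) = m∸n≡1+[m∸1+n] m n n<m

-- Writing x = q b + s with s < b, the recursion removes q + [j < s] from x at step j.
residual-closed : ∀ b q s j → s < b → j < b → residual b j (q * b + s) ≡ q * suc (b ∸ suc j) + (s ∸ j)
residual-closed (suc b) q s zero    s<b j<b = refl
residual-closed b       q s (suc j) s<b j<b = begin
  residual b j x ∸ ceilDivSuc (residual b j x) d           ≡⟨ cong (λ z → z ∸ ceilDivSuc z d) previous ⟩
  q * suc d + (s ∸ j) ∸ ceilDivSuc (q * suc d + (s ∸ j)) d ≡⟨ ∸-ceilDivSuc d q (s ∸ j) (∸-monoˡ-≤ (suc j) s<b) ⟩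
  q * d + pred (s ∸ j)                                     ≡⟨ cong₂ (λ e f → q * e + f) (m∸n≡1+[m∸1+n] b (suc j) j<b)
                                                                                  (pred[m∸n]≡m∸[1+n] s j) ⟩
  q * suc (b ∸ suc (suc j)) + (s ∸ suc j)                  ∎
  where
  open ≡-Reasoning
  x = q * b + s
  d = b ∸ suc j
  previous : residual b j x ≡ q * suc d + (s ∸ j)
  previous = residual-closed b q s j s<b (<⇒≤ j<b)

vvec-entry-closed : ∀ b q s i → s < b → i < b → ceilDivSuc (residual b i (q * b + s)) (b ∸ suc i) ≡ q + 𝟙[ i < s ]
vvec-entry-closed b q s i s<b i<b = begin
  ceilDivSuc (residual b i (q * b + s)) d         ≡⟨ cong (λ z → ceilDivSuc z d) (residual-closed b q s i s<b i<b) ⟩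
  ceilDivSuc (q * suc d + (s ∸ i)) d              ≡⟨ ceilDivSuc-multiple d q (s ∸ i) (∸-monoˡ-≤ (suc i) s<b) ⟩
  q + 𝟙[ 0 < s ∸ i ]                              ≡⟨ cong (q +_) (𝟙[0<n∸m]≡𝟙[m<n] i s) ⟩
  q + 𝟙[ i < s ]                                  ∎
  where
  open ≡-Reasoning
  d = b ∸ suc i

count<-progression : ∀ b i s → i < b → s < b → ∀ n q → q * b + s ≤ n * b →
                     count< (q * b + s) (applyUpTo (λ m → m * b + i) n) ≡ q + 𝟙[ i < s ]
count<-progression (suc b) i s i<b s<b zero    zero    s≤0 = sym (≥⇒𝟙≡0 (≤-trans s≤0 z≤n))
count<-progression (suc b) i s i<b s<b zero    (suc q) ()
count<-progression (suc b) i s i<b s<b (suc n) zero    _   =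
  trans (cong (𝟙[ i < s ] +_) (count<-all≥ (applyUpTo⁺₁ (λ m → suc m * suc b + i) n (λ {m} _ → s≤later m))))
        (+-identityʳ _)
  where
  s≤later : ∀ m → s ≤ suc m * suc b + i
  s≤later m = ≤-trans (<⇒≤ s<b) (≤-trans (m≤m+n (suc b) (m * suc b)) (m≤m+n _ i))
count<-progression (suc b) i s i<b s<b (suc n) (suc q) le =
  cong₂ _+_ (<⇒𝟙≡1 (≤-trans i<b (≤-trans (m≤m+n (suc b) (q * suc b)) (m≤m+n _ s))))
            (trans (count<-applyUpTo-cong _ _ n (λ {m} _ → shift m))
                   (count<-progression (suc b) i s i<b s<b n q (+-cancelˡ-≤ (suc b) _ _ le′)))
  where
  shift : ∀ m → 𝟙[ suc m * suc b + i < suc q * suc b + s ] ≡ 𝟙[ m * suc b + i < q * suc b + s ]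
  shift m = trans (cong₂ 𝟙[_<_] (+-assoc (suc b) (m * suc b) i) (+-assoc (suc b) (q * suc b) s))
                  (𝟙-+-cancelˡ (suc b) (m * suc b + i) (q * suc b + s))
  le′ : suc b + (q * suc b + s) ≤ suc b + n * suc b
  le′ = subst (_≤ suc b + n * suc b) (+-assoc (suc b) (q * suc b) s) le

count<-progression-ceil : ∀ b i n c → i < b → c ≤ n * b →
  count< c (applyUpTo (λ m → m * b + i) n) ≡ ceilDivSuc (residual b i c) (b ∸ suc i)
count<-progression-ceil (suc b) i n c i<b c≤nb = begin
  count< c (applyUpTo (λ m → m * suc b + i) n)          ≡⟨ cong (λ z → count< z (applyUpTo (λ m → m * suc b + i) n)) c≡qb+s ⟩
  count< (q * suc b + s) (applyUpTo (λ m → m * suc b + i) n)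
    ≡⟨ count<-progression (suc b) i s i<b s<b n q (subst (_≤ n * suc b) c≡qb+s c≤nb) ⟩
  q + 𝟙[ i < s ]                                         ≡⟨ vvec-entry-closed (suc b) q s i s<b i<b ⟨
  ceilDivSuc (residual (suc b) i (q * suc b + s)) (b ∸ i) ≡⟨ cong (λ z → ceilDivSuc (residual (suc b) i z) (b ∸ i)) c≡qb+s ⟨
  ceilDivSuc (residual (suc b) i c) (b ∸ i)              ∎
  where
  open ≡-Reasoning
  q = c / suc b
  s = c % suc b
  s<b : s < suc b
  s<b = m%n<n c (suc b)
  c≡qb+s : c ≡ q * suc b + s
  c≡qb+s = trans (m≡m%n+[m/n]*n c (suc b)) (+-comm s (q * suc b))

strip-index< : ∀ {b n i m} → i < b → m < n → m * b + i < b * n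
strip-index< {b} {n} {i} {m} i<b m<n = begin-strict
  m * b + i  <⟨ +-monoʳ-< (m * b) i<b ⟩
  m * b + b  ≡⟨ +-comm (m * b) b ⟩
  suc m * b  ≤⟨ *-monoˡ-≤ b m<n ⟩
  n * b      ≡⟨ *-comm n b ⟩
  b * n      ∎
  where open ≤-Reasoning

count<-strip : ∀ {b n i H} c → i < b → AllPairs _≤_ H → length H ≡ b * n →
  count< c (strip b n i H) ≡ ceilDivSuc (residual b i (count< c H)) (b ∸ suc i)
count<-strip {b} {n} {i} {H} c i<b sorted len = begin
  count< c (strip b n i H)                          ≡⟨ cong (count< c) (map-upTo (λ m → nth H (m * b + i)) n) ⟩
  count< c (applyUpTo (λ m → nth H (m * b + i)) n)  ≡⟨ count<-applyUpTo-cong _ _ n entryBelow ⟩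
  count< (count< c H) (applyUpTo (λ m → m * b + i) n)
    ≡⟨ count<-progression-ceil b i n (count< c H) i<b
         (≤-trans (count<≤length c H) (≤-reflexive (trans len (*-comm b n)))) ⟩
  ceilDivSuc (residual b i (count< c H)) (b ∸ suc i) ∎
  where
  open ≡-Reasoning
  entryBelow : ∀ {m} → m < n → 𝟙[ nth H (m * b + i) < c ] ≡ 𝟙[ m * b + i < count< c H ]
  entryBelow {m} m<n =
    sorted-nth<⇔<count< c (m * b + i) sorted (subst (m * b + i <_) (sym len) (strip-index< i<b m<n))

stepSeq-strip : ∀ {b n i} π p → i < b → countE π ≡ b * n → countN p ≡ countN π →
  heightSeq p ≡ strip b n i (heightSeq π) → stepSeq p ≡ vvec b (stepSeq π) i
stepSeq-strip {b} {n} {i} π p i<b πE pN hp = begin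
  stepSeq p                                                ≡⟨ stepSeq-counts p ⟩
  applyUpTo (λ k → count< (suc k) (heightSeq p)) (countN p) ≡⟨ cong₂ (λ hs r → applyUpTo (λ k → count< (suc k) hs) r) hp pN ⟩
  applyUpTo (λ k → count< (suc k) (strip b n i H)) (countN π)
    ≡⟨ applyUpTo-cong (countN π) (λ k → count<-strip (suc k) i<b (heightSeqFrom-sorted 0 π) lenH) ⟩
  applyUpTo (λ k → v (count< (suc k) H)) (countN π)         ≡⟨ map-applyUpTo (λ k → count< (suc k) H) v (countN π) ⟨
  map v (applyUpTo (λ k → count< (suc k) H) (countN π))     ≡⟨ cong (map v) (stepSeq-counts π) ⟨
  map v (stepSeq π)                                        ≡⟨ vvec-map b (stepSeq π) i ⟨
  vvec b (stepSeq π) i                                     ∎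
  where
  open ≡-Reasoning
  H = heightSeq π
  v : ℕ → ℕ
  v x = ceilDivSuc (residual b i x) (b ∸ suc i)
  lenH : length H ≡ b * n
  lenH = trans (length-heightSeqFrom 0 π) πE

Ascending : ℕ → ℕ → List ℕ → Set
Ascending y A []       = y ≤ A
Ascending y A (h ∷ hs) = y ≤ h × Ascending h A hs

ascending : ∀ {y A L} → AllPairs _≤_ L → All (y ≤_) L → All (_≤ A) L → y ≤ A → Ascending y A L
ascending {L = []}    _              _         _            y≤A = y≤A
ascending {L = _ ∷ _} (h≤L ∷ sorted) (y≤h ∷ _) (h≤A ∷ L≤A) _   = y≤h , ascending sorted h≤L L≤A h≤A

ascending-top : ∀ {y A} L → Ascending y A L → y ≤ A
ascending-top []      y≤A          = y≤A
ascending-top (_ ∷ L) (y≤h , asc) = ≤-trans y≤h (ascending-top L asc)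

pathFrom : ℕ → ℕ → List ℕ → List Step
pathFrom y A []       = replicate (A ∸ y) N
pathFrom y A (h ∷ hs) = replicate (h ∸ y) N ++ E ∷ pathFrom h A hs

heightSeqFrom-N^k++ : ∀ k y s → heightSeqFrom y (replicate k N ++ s) ≡ heightSeqFrom (k + y) s
heightSeqFrom-N^k++ zero    y s = refl
heightSeqFrom-N^k++ (suc k) y s = trans (heightSeqFrom-N^k++ k (suc y) s) (cong (λ z → heightSeqFrom z s) (+-suc k y))

countN-N^k++ : ∀ k s → countN (replicate k N ++ s) ≡ k + countN s
countN-N^k++ zero    s = refl
countN-N^k++ (suc k) s = cong suc (countN-N^k++ k s)

countE-N^k++ : ∀ k s → countE (replicate k N ++ s) ≡ countE s
countE-N^k++ zero    s = refl
countE-N^k++ (suc k) s = countE-N^k++ k s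

heightSeqFrom-pathFrom : ∀ y A L → Ascending y A L → heightSeqFrom y (pathFrom y A L) ≡ L
heightSeqFrom-pathFrom y A []       _           =
  trans (cong (heightSeqFrom y) (sym (++-identityʳ (replicate (A ∸ y) N)))) (heightSeqFrom-N^k++ (A ∸ y) y [])
heightSeqFrom-pathFrom y A (h ∷ hs) (y≤h , asc) = begin
  heightSeqFrom y (replicate (h ∸ y) N ++ E ∷ pathFrom h A hs) ≡⟨ heightSeqFrom-N^k++ (h ∸ y) y _ ⟩
  heightSeqFrom (h ∸ y + y) (E ∷ pathFrom h A hs)             ≡⟨ cong (λ z → heightSeqFrom z (E ∷ pathFrom h A hs)) (m∸n+n≡m y≤h) ⟩
  h ∷ heightSeqFrom h (pathFrom h A hs)                        ≡⟨ cong (h ∷_) (heightSeqFrom-pathFrom h A hs asc) ⟩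
  h ∷ hs                                                       ∎
  where open ≡-Reasoning

countE-pathFrom : ∀ y A L → countE (pathFrom y A L) ≡ length L
countE-pathFrom y A []       = trans (cong countE (sym (++-identityʳ (replicate (A ∸ y) N)))) (countE-N^k++ (A ∸ y) [])
countE-pathFrom y A (h ∷ hs) = trans (countE-N^k++ (h ∸ y) _) (cong suc (countE-pathFrom h A hs))

∸-telescope : ∀ {y h A} → y ≤ h → h ≤ A → (h ∸ y) + (A ∸ h) ≡ A ∸ y
∸-telescope {zero}                  _         h≤A       = m+[n∸m]≡n h≤A
∸-telescope {suc y} {suc h} {suc A} (s≤s y≤h) (s≤s h≤A) = ∸-telescope y≤h h≤A

countN-pathFrom : ∀ y A L → Ascending y A L → countN (pathFrom y A L) ≡ A ∸ y
countN-pathFrom y A []       _           =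
  trans (cong countN (sym (++-identityʳ (replicate (A ∸ y) N)))) (trans (countN-N^k++ (A ∸ y) []) (+-identityʳ _))
countN-pathFrom y A (h ∷ hs) (y≤h , asc) =
  trans (countN-N^k++ (h ∸ y) _)
        (trans (cong (h ∸ y +_) (countN-pathFrom h A hs asc)) (∸-telescope y≤h (ascending-top hs asc)))

strip-path : ∀ {b n i A} π → i < b → IsLatticePath (b * n) A π →
  ∃[ p ] (IsLatticePath n A p × heightSeq p ≡ strip b n i (heightSeq π))
strip-path {b} {n} {i} {A} π i<b (πE , πN) =
  pathFrom 0 A L ,
  (trans (countE-pathFrom 0 A L) (length-applyUpTo g n) , countN-pathFrom 0 A L asc) ,
  trans (heightSeqFrom-pathFrom 0 A L asc) (sym (map-upTo g n))
  where
  H = heightSeq π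
  g : ℕ → ℕ
  g m = nth H (m * b + i)
  L = applyUpTo g n
  inRange : ∀ {m} → m < n → m * b + i < length H
  inRange m<n = subst (_ <_) (sym (trans (length-heightSeqFrom 0 π) πE)) (strip-index< i<b m<n)
  asc : Ascending 0 A L
  asc = ascending
    (AllPairs.applyUpTo⁺₁ g n (λ m<m′ m′<n →
       sorted-nth-mono (heightSeqFrom-sorted 0 π) (+-monoˡ-≤ i (*-monoˡ-≤ b (<⇒≤ m<m′))) (inRange m′<n)))
    (applyUpTo⁺₂ g n (λ _ → z≤n))
    (applyUpTo⁺₁ g n (λ {m} m<n → subst (g m ≤_) πN (nth∈All (m * b + i) (heightSeqFrom-≤ 0 π) (inRange m<n))))
    z≤n

mainTheorem2 : (a b n : ℕ) → 0 < a → 0 < b → Coprime a b → 1 ≤ n →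
    (π : List Step) → IsDyck a b n π → (i : Fin b) →
    (∃[ p ] (IsLatticePath n (a * n) p × heightSeq p ≡ strip b n (toℕ i) (heightSeq π))) ×
    ((p : List Step) → IsLatticePath n (a * n) p →
      heightSeq p ≡ strip b n (toℕ i) (heightSeq π) →
      stepSeq p ≡ vvec b (stepSeq π) (toℕ i))
mainTheorem2 a b n _ _ _ _ π (πPath@(πE , πN) , _) i =
  strip-path π (toℕ<n i) πPath ,
  λ p (_ , pN) → stepSeq-strip π p (toℕ<n i) πE (trans pN (sym πN))
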